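{- Let $k$ be any integer and let $n \in C_k$. If $n>2$, then $k \equiv n \pmod{2}$.
   Context: For an integer $k$, $C_k$ denotes the set of integers $n>\max(k,0)$ such that $a^{n-k+1}\equiv a \pmod{n}$ for all integers $a$. -}

module Defs where

open import Data.Nat using (ℕ)
open import Data.Integer using (ℤ; +_; _-_; _+_; _^_; _<_; ∣_∣)
open import Data.Integer.Divisibility using (_∣_)
open import Data.Product using (_×_)

_≡_[mod_] : ℤ → ℤ → ℤ → Set
a ≡ b [mod m ] = m ∣ (a - b)

-- Since n > k, the exponent n - k + 1 ≥ 2 is a positive integer; we take it as the
-- natural number ∣ n - k + 1 ∣, which equals n - k + 1 under this hypothesis.
InC : ℤ → ℕ → Set
InC k n = (k < + n) × (+ 0 < + n) ×
  ((a : ℤ) → (a ^ ∣ (+ n - k) + + 1 ∣) ≡ a [mod + n ])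

-- Take a = -1. If the exponent e = n - k + 1 were even, then (-1)^e = 1 ≡ -1 (mod n),
-- so n would divide 2, which is impossible for n > 2. Hence e is odd, i.e. n - k is even.
module Submission where

open import Defs
open import Data.Nat using (ℕ; _<_)
open import Data.Integer using (ℤ; +_; _-_)
open import Data.Integer.Divisibility using (_∣_)

import Data.Nat as ℕ
import Data.Nat.Properties as ℕ
import Data.Nat.Divisibility as ℕ
open import Data.Integer using (+≤+; 1ℤ; -1ℤ; _+_; _*_; -_; _^_; ∣_∣)
open import Data.Integer.Properties using (-1*i≡-i; neg-involutive; 0≤i⇒+∣i∣≡i; i≤j⇒0≤j-i; <⇒≤; +-mono-≤)
import Data.Integer.Divisibility.Signed as Signed
open import Data.Integer.Tactic.RingSolver using (solve-∀)
open import Data.Sum using (_⊎_; inj₁; inj₂)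
open import Data.Product using (_,_)
open import Relation.Binary.PropositionalEquality
open import Relation.Nullary using (¬_; contradiction)

-1^[2+m]≡-1^m : ∀ m → -1ℤ ^ (2 ℕ.+ m) ≡ -1ℤ ^ m
-1^[2+m]≡-1^m m = begin
  -1ℤ * (-1ℤ * -1ℤ ^ m) ≡⟨ cong (-1ℤ *_) (-1*i≡-i (-1ℤ ^ m)) ⟩
  -1ℤ * - (-1ℤ ^ m)     ≡⟨ -1*i≡-i (- (-1ℤ ^ m)) ⟩
  - - (-1ℤ ^ m)         ≡⟨ neg-involutive (-1ℤ ^ m) ⟩
  -1ℤ ^ m               ∎
  where open ≡-Reasoning

-1^m≡1⊎odd : ∀ m → -1ℤ ^ m ≡ 1ℤ ⊎ 2 ℕ.∣ ℕ.suc m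
-1^m≡1⊎odd 0 = inj₁ refl
-1^m≡1⊎odd 1 = inj₂ ℕ.∣-refl
-1^m≡1⊎odd (ℕ.suc (ℕ.suc m)) with -1^m≡1⊎odd m
... | inj₁ even = inj₁ (trans (-1^[2+m]≡-1^m m) even)
... | inj₂ odd  = inj₂ (ℕ.∣m∣n⇒∣m+n ℕ.∣-refl odd)

1≢-1-mod : ∀ {n} → 2 < n → ¬ (1ℤ ≡ -1ℤ [mod + n ])
1≢-1-mod 2<n n∣2 = contradiction (ℕ.∣⇒≤ n∣2) (ℕ.<⇒≱ 2<n)

-1^m≡-1-mod⇒odd : ∀ {n m} → 2 < n → (-1ℤ ^ m) ≡ -1ℤ [mod + n ] → 2 ℕ.∣ ℕ.suc m
-1^m≡-1-mod⇒odd {n} {m} 2<n -1^m≡-1 with -1^m≡1⊎odd m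
... | inj₁ even = contradiction (subst (λ x → x ≡ -1ℤ [mod + n ]) even -1^m≡-1) (1≢-1-mod 2<n)
... | inj₂ odd  = odd

k-n≡2-[1+[n-k+1]] : ∀ k n → k - n ≡ + 2 - (+ 1 + ((n - k) + + 1))
k-n≡2-[1+[n-k+1]] = solve-∀

proposition4p2 : (k : ℤ) (n : ℕ) → InC k n → 2 < n → (+ 2) ∣ (k - + n)
proposition4p2 k n (k<n , _ , fermat) 2<n =
  Signed.∣⇒∣ᵤ (subst (Signed._∣_ (+ 2)) (sym k-n≡2-[1+e])
    (Signed.∣m∣n⇒∣m-n Signed.∣-refl (Signed.∣ᵤ⇒∣ {i = + ℕ.suc ∣ e ∣} e-odd)))
  where
  e : ℤ
  e = (+ n - k) + + 1
  e-odd : 2 ℕ.∣ ℕ.suc ∣ e ∣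
  e-odd = -1^m≡-1-mod⇒odd 2<n (fermat -1ℤ)
  +∣e∣≡e : + ∣ e ∣ ≡ e
  +∣e∣≡e = 0≤i⇒+∣i∣≡i (+-mono-≤ (i≤j⇒0≤j-i (<⇒≤ k<n)) (+≤+ ℕ.z≤n))
  k-n≡2-[1+e] : k - + n ≡ + 2 - + ℕ.suc ∣ e ∣
  k-n≡2-[1+e] = trans (k-n≡2-[1+[n-k+1]] k (+ n)) (cong (λ x → + 2 - (+ 1 + x)) (sym +∣e∣≡e))
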